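{- A GT-word $w$ is rich if and only if the heart of $w$ is rich.
   Context: Words are finite sequences of letters; $|w|$ is the length and $\mathrm{Alph}(w)$ the set of letters of $w$. A factor is a contiguous subword. A palindrome is a word equal to its reversal (the empty word included). A finite word $w$ is rich if it has exactly $|w|+1$ distinct palindromic factors (including the empty word). $C_w(n)$ is the number of distinct factors of $w$ of length $n$. A word $w$ with $|\mathrm{Alph}(w)|\ge 2$ is a GT-word if there exist positive integers $m\le M$ such that $C_w(0)=1$, $C_w(i)=|\mathrm{Alph}(w)|+i-1$ for $1\le i\le m$, $C_w(i+1)=C_w(i)$ for $m\le i\le M-1$, and $C_w(i+1)=C_w(i)-1$ for $M\le i\le |w|$ (with $C_w(|w|+1)=0$). Every non-empty word with one distinct letter is also a GT-word. Heart: for a non-empty word $w$, let $r$ be the longest (possibly empty) prefix of $w$ all of whose letters occur exactly once in $w$, and $s$ the longest (possibly empty) suffix of $w$ all of whose letters occur exactly once in $w$. If $|w|>|\mathrm{Alph}(w)|$, the heart of $w$ is the unique non-empty $v$ with $w=rvs$; otherwise the heart of $w$ is $w$. -}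

module Defs where

open import Data.Nat using (ℕ; zero; suc; _+_; _∸_; _≤_; _<_)
open import Data.Nat.Properties using () renaming (_≟_ to _≟ℕ_)
open import Data.List using (List; []; _∷_; length; filter; reverse; take; drop; tails; inits; concatMap; map; deduplicate; takeWhile)
open import Data.List.Properties using (≡-dec)
open import Data.Product using (Σ; _×_; _,_; ∃-syntax)
open import Data.Sum using (_⊎_)
open import Relation.Binary.Definitions using (DecidableEquality)
open import Relation.Binary.PropositionalEquality using (_≡_)
open import Relation.Nullary using (Dec; yes; no; ¬_)
open import Data.Nat using (_<?_)

module _ {A : Set} (_≟_ : DecidableEquality A) where

  _≟w_ : DecidableEquality (List A)
  _≟w_ = ≡-dec _≟_

  Alph : List A → List A
  Alph w = deduplicate _≟_ w

  occ : A → List A → ℕ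
  occ a w = length (filter (_≟ a) w)

  factors : List A → List (List A)
  factors w = concatMap inits (tails w)

  C : List A → ℕ → ℕ
  C w n = length (deduplicate _≟w_ (filter (λ u → length u ≟ℕ n) (factors w)))

  isPal : (u : List A) → Dec (u ≡ reverse u)
  isPal u = u ≟w reverse u

  -- number of distinct palindromic factors (the empty word included)
  palCount : List A → ℕ
  palCount w = length (deduplicate _≟w_ (filter isPal (factors w)))

  Rich : List A → Set
  Rich w = palCount w ≡ suc (length w)

  IsGT : List A → Set
  IsGT w =
    (2 ≤ length (Alph w) ×
      ∃[ m ] ∃[ M ] (1 ≤ m × m ≤ M
        × C w 0 ≡ 1
        × (∀ i → 1 ≤ i → i ≤ m → C w i ≡ length (Alph w) + i ∸ 1)
        × (∀ i → m ≤ i → i ≤ M ∸ 1 → C w (suc i) ≡ C w i)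
        × (∀ i → M ≤ i → i ≤ length w → C w (suc i) + 1 ≡ C w i)))
    ⊎ (¬ (w ≡ []) × length (Alph w) ≡ 1)

  once? : (w : List A) → (a : A) → Dec (occ a w ≡ 1)
  once? w a = occ a w ≟ℕ 1

  prefR : List A → List A
  prefR w = takeWhile (once? w) w

  sufS : List A → List A
  sufS w = reverse (takeWhile (once? w) (reverse w))

  -- heart: if |w| > |Alph w| then the v with w = r v s, else w itself
  heart : List A → List A
  heart w with length (Alph w) <? length w
  ... | yes _ = drop (length (prefR w)) (take (length w ∸ length (sufS w)) w)
  ... | no _  = w

module Submission where

-- The heart of w is obtained by cutting off a prefix r and a suffix s all
-- of whose letters occur exactly once in w, and such a letter contributes
-- exactly one new palindromic factor (the letter itself), because a
-- palindrome of length at least two repeats its first letter.  Hence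
--   palCount (r ++ v ++ s) = |r| + |s| + palCount v   and
--   |r ++ v ++ s| + 1     = |r| + |s| + (|v| + 1),
-- so w is rich iff v is rich.

open import Defs
open import Data.Nat using (ℕ; suc; _+_; _∸_; _≤_; _<_; _<?_; s≤s; s≤s⁻¹)
open import Data.Nat.Properties
  using (≤-total; ≤-trans; ≤-reflexive; <⇒≢; m≤n+m; m+n∸n≡m; +-cancelˡ-≡; +-comm; +-assoc; n≤0⇒n≡0)
open import Data.Nat.Tactic.RingSolver using (solve-∀)
open import Data.List
  using (List; []; _∷_; [_]; _++_; length; filter; reverse; take; drop; inits; deduplicate; takeWhile; dropWhile)
open import Data.List.Properties
  using (length-++; ++-assoc; reverse-++; reverse-involutive; length-reverse; unfold-reverse;
         ∷-injective; ∷-injectiveʳ; filter-all; filter-++; filter-accept; filter-some; takeWhile++dropWhile)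
open import Data.List.Membership.Propositional using (_∈_; _∉_)
open import Data.List.Membership.Propositional.Properties
  using (∈-filter⁺; ∈-filter⁻; ∈-++⁺ˡ; ∈-++⁺ʳ; ∈-++⁻; ∈-map⁺; ∈-map⁻; deduplicate-∈⇔)
open import Data.List.Membership.Propositional.Properties.WithK using (unique∧set⇒bag)
open import Data.List.Relation.Binary.BagAndSetEquality using (∼bag⇒↭)
open import Data.List.Relation.Binary.Permutation.Propositional.Properties using (↭-length)
open import Data.List.Relation.Unary.Any using (here; there)
import Data.List.Relation.Unary.Any as Any
import Data.List.Relation.Unary.Any.Properties as AnyP
import Data.List.Relation.Unary.All as All
open import Data.List.Relation.Unary.All.Properties using (all-takeWhile)
open import Data.Product using (_,_; ∃-syntax; proj₁; proj₂)
open import Data.Sum using (_⊎_; inj₁; inj₂)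
open import Data.Empty using (⊥-elim)
open import Function.Bundles using (_⇔_; mk⇔; Equivalence)
import Function.Properties.Equivalence as ⇔
open import Relation.Binary.Definitions using (DecidableEquality)
open import Relation.Binary.PropositionalEquality
  using (_≡_; refl; sym; trans; cong; cong₂; subst; module ≡-Reasoning)
open import Relation.Nullary using (Dec; ¬_; ¬?; yes; no)

module _ {B : Set} (_≟_ : DecidableEquality B) where
  open import Data.List.Relation.Unary.Unique.DecPropositional.Properties _≟_ using (deduplicate-!)

  dedup-length-cong : ∀ {xs ys : List B} → (∀ {z} → z ∈ xs ⇔ z ∈ ys) →
                      length (deduplicate _≟_ xs) ≡ length (deduplicate _≟_ ys)
  dedup-length-cong {xs} {ys} same =
    ↭-length (∼bag⇒↭ (unique∧set⇒bag (deduplicate-! xs) (deduplicate-! ys)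
      (⇔.trans (⇔.sym (deduplicate-∈⇔ _≟_ {xs})) (⇔.trans same (deduplicate-∈⇔ _≟_ {ys})))))

  dedup-length-fresh : ∀ {x : B} {xs} → x ∉ xs →
                       length (deduplicate _≟_ (x ∷ xs)) ≡ suc (length (deduplicate _≟_ xs))
  dedup-length-fresh {x} {xs} x∉xs =
    cong (λ l → suc (length l)) (filter-all (λ z → ¬? (x ≟ z)) (All.tabulate x≢))
    where
    x≢ : ∀ {z} → z ∈ deduplicate _≟_ xs → ¬ (x ≡ z)
    x≢ z∈ refl = x∉xs (Equivalence.from (deduplicate-∈⇔ _≟_ {xs}) z∈)

-- The passage between the two equations defining richness of w and of v,
-- when palindromes and length both exceed those of v by the same k.
shift-⇔ : ∀ k {x y m n : ℕ} → x ≡ k + y → m ≡ k + n → (x ≡ m ⇔ y ≡ n)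
shift-⇔ k refl refl = mk⇔ (+-cancelˡ-≡ k _ _) (cong (k +_))

module _ {A : Set} (_≟_ : DecidableEquality A) where

  inits-sound : ∀ (w z : List A) → z ∈ inits w → ∃[ y ] z ++ y ≡ w
  inits-sound [] .[] (here refl) = [] , refl
  inits-sound (a ∷ u) .[] (here refl) = a ∷ u , refl
  inits-sound (a ∷ u) z (there p) with ∈-map⁻ (a ∷_) p
  ... | z′ , q , refl with inits-sound u z′ q
  ...   | y , refl = y , refl

  inits-complete : ∀ (z y : List A) → z ∈ inits (z ++ y)
  inits-complete [] [] = here refl
  inits-complete [] (_ ∷ _) = here refl
  inits-complete (b ∷ z) y = there (∈-map⁺ (b ∷_) (inits-complete z y))

  factors-sound : ∀ (w z : List A) → z ∈ factors _≟_ w → ∃[ x ] ∃[ y ] x ++ z ++ y ≡ w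
  factors-sound [] .[] (here refl) = [] , [] , refl
  factors-sound (a ∷ u) z p with ∈-++⁻ (inits (a ∷ u)) p
  ... | inj₁ q = let (y , e) = inits-sound (a ∷ u) z q in [] , y , e
  ... | inj₂ q with factors-sound u z q
  ...   | x , y , refl = a ∷ x , y , refl

  factors-complete : ∀ (x z y : List A) → z ∈ factors _≟_ (x ++ z ++ y)
  factors-complete [] [] [] = here refl
  factors-complete [] z y = ∈-++⁺ˡ (inits-complete z y)
  factors-complete (a ∷ x) z y = ∈-++⁺ʳ (inits (a ∷ x ++ z ++ y)) (factors-complete x z y)

  PalFactors : List A → List (List A)
  PalFactors w = filter (isPal _≟_) (factors _≟_ w)

  palFactor : ∀ x z y → z ≡ reverse z → z ∈ PalFactors (x ++ z ++ y)
  palFactor x z y = ∈-filter⁺ (isPal _≟_) (factors-complete x z y)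

  palFactor-reverse : ∀ w {z} → z ∈ PalFactors w → z ∈ PalFactors (reverse w)
  palFactor-reverse w {z} p with ∈-filter⁻ (isPal _≟_) {xs = factors _≟_ w} p
  ... | z∈ , pal with factors-sound w z z∈
  ...   | x , y , refl = subst (λ t → z ∈ PalFactors t) (sym reversed) (palFactor (reverse y) z (reverse x) pal)
    where
    open ≡-Reasoning
    reversed : reverse (x ++ z ++ y) ≡ reverse y ++ z ++ reverse x
    reversed = begin
      reverse (x ++ z ++ y)                 ≡⟨ reverse-++ x (z ++ y) ⟩
      reverse (z ++ y) ++ reverse x         ≡⟨ cong (_++ reverse x) (reverse-++ z y) ⟩
      (reverse y ++ reverse z) ++ reverse x ≡⟨ ++-assoc (reverse y) (reverse z) (reverse x) ⟩
      reverse y ++ reverse z ++ reverse x   ≡⟨ cong (λ t → reverse y ++ t ++ reverse x) (sym pal) ⟩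
      reverse y ++ z ++ reverse x           ∎

  palCount-reverse : ∀ w → palCount _≟_ (reverse w) ≡ palCount _≟_ w
  palCount-reverse w = dedup-length-cong (_≟w_ _≟_) (mk⇔ back (palFactor-reverse w))
    where
    back : ∀ {z} → z ∈ PalFactors (reverse w) → z ∈ PalFactors w
    back {z} p = subst (λ t → z ∈ PalFactors t) (reverse-involutive w) (palFactor-reverse (reverse w) p)

  last∈tail : ∀ {a c : A} ys zs → a ∷ ys ≡ zs ++ [ c ] → ys ≡ [] ⊎ c ∈ ys
  last∈tail ys [] e = inj₁ (∷-injectiveʳ e)
  last∈tail {c = c} ys (_ ∷ zs) e = inj₂ (subst (c ∈_) (sym (∷-injectiveʳ e)) (∈-++⁺ʳ zs (here refl)))

  pal-head∈tail : ∀ (a b : A) t → a ∷ b ∷ t ≡ reverse (a ∷ b ∷ t) → a ∈ b ∷ t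
  pal-head∈tail a b t pal with last∈tail (b ∷ t) (reverse (b ∷ t)) (trans pal (unfold-reverse a (b ∷ t)))
  ... | inj₁ ()
  ... | inj₂ a∈ = a∈

  module _ {a : A} {u : List A} (a∉u : a ∉ u) where

    fresh-head-factor : ∀ x z y → x ++ z ++ y ≡ a ∷ u → z ≡ reverse z → z ∈ [ a ] ∷ PalFactors u
    fresh-head-factor [] [] y refl pal = there (palFactor [] [] u refl)
    fresh-head-factor [] (b ∷ []) y refl pal = here refl
    fresh-head-factor [] (b ∷ c ∷ t) y refl pal = ⊥-elim (a∉u (∈-++⁺ˡ (pal-head∈tail b c t pal)))
    fresh-head-factor (b ∷ x) z y refl pal = there (palFactor x z y pal)

    palFactors-fresh-head : ∀ {z} → z ∈ PalFactors (a ∷ u) ⇔ z ∈ [ a ] ∷ PalFactors u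
    palFactors-fresh-head {z} = mk⇔ to from
      where
      to : z ∈ PalFactors (a ∷ u) → z ∈ [ a ] ∷ PalFactors u
      to p with ∈-filter⁻ (isPal _≟_) {xs = factors _≟_ (a ∷ u)} p
      ... | z∈ , pal = let (x , y , e) = factors-sound (a ∷ u) z z∈ in fresh-head-factor x z y e pal
      from : z ∈ [ a ] ∷ PalFactors u → z ∈ PalFactors (a ∷ u)
      from (here refl) = palFactor [] [ a ] u refl
      from (there p) with ∈-filter⁻ (isPal _≟_) {xs = factors _≟_ u} p
      ... | z∈ , pal with factors-sound u z z∈
      ...   | x , y , refl = palFactor (a ∷ x) z y pal

    [a]∉palFactors : [ a ] ∉ PalFactors u
    [a]∉palFactors p with factors-sound u [ a ] (proj₁ (∈-filter⁻ (isPal _≟_) {xs = factors _≟_ u} p))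
    ... | x , y , refl = a∉u (∈-++⁺ʳ x (here refl))

    palCount-fresh-head : palCount _≟_ (a ∷ u) ≡ suc (palCount _≟_ u)
    palCount-fresh-head = trans (dedup-length-cong (_≟w_ _≟_) palFactors-fresh-head)
                                (dedup-length-fresh (_≟w_ _≟_) [a]∉palFactors)

  occ-++ : ∀ a xs ys → occ _≟_ a (xs ++ ys) ≡ occ _≟_ a xs + occ _≟_ a ys
  occ-++ a xs ys = trans (cong length (filter-++ (_≟ a) xs ys)) (length-++ (filter (_≟ a) xs))

  occ-suffix : ∀ a xs ys → occ _≟_ a ys ≤ occ _≟_ a (xs ++ ys)
  occ-suffix a xs ys = subst (occ _≟_ a ys ≤_) (sym (occ-++ a xs ys)) (m≤n+m _ _)

  occ-reverse : ∀ a xs → occ _≟_ a (reverse xs) ≡ occ _≟_ a xs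
  occ-reverse a [] = refl
  occ-reverse a (x ∷ xs) = begin
    occ _≟_ a (reverse (x ∷ xs))                ≡⟨ cong (occ _≟_ a) (unfold-reverse x xs) ⟩
    occ _≟_ a (reverse xs ++ [ x ])             ≡⟨ occ-++ a (reverse xs) [ x ] ⟩
    occ _≟_ a (reverse xs) + occ _≟_ a [ x ]    ≡⟨ cong (_+ occ _≟_ a [ x ]) (occ-reverse a xs) ⟩
    occ _≟_ a xs + occ _≟_ a [ x ]              ≡⟨ +-comm (occ _≟_ a xs) _ ⟩
    occ _≟_ a [ x ] + occ _≟_ a xs              ≡⟨ occ-++ a [ x ] xs ⟨
    occ _≟_ a (x ∷ xs)                          ∎
    where open ≡-Reasoning

  occ-head≤1⇒∉ : ∀ a xs → occ _≟_ a (a ∷ xs) ≤ 1 → a ∉ xs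
  occ-head≤1⇒∉ a xs once a∈xs = <⇒≢ (filter-some (_≟ a) (Any.map sym a∈xs)) (sym none)
    where
    none : occ _≟_ a xs ≡ 0
    none = n≤0⇒n≡0 (s≤s⁻¹ (subst (_≤ 1) (cong length (filter-accept (_≟ a) refl)) once))

  palCount-once-prefix : ∀ p v → (∀ a → a ∈ p → occ _≟_ a (p ++ v) ≤ 1) →
                         palCount _≟_ (p ++ v) ≡ length p + palCount _≟_ v
  palCount-once-prefix [] v once = refl
  palCount-once-prefix (a ∷ p) v once =
    trans (palCount-fresh-head (occ-head≤1⇒∉ a (p ++ v) (once a (here refl))))
          (cong suc (palCount-once-prefix p v once-tail))
    where
    once-tail : ∀ b → b ∈ p → occ _≟_ b (p ++ v) ≤ 1
    once-tail b b∈p = ≤-trans (occ-suffix b [ a ] (p ++ v)) (once b (there b∈p))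

  palCount-once-suffix : ∀ v q → (∀ a → a ∈ q → occ _≟_ a (v ++ q) ≤ 1) →
                         palCount _≟_ (v ++ q) ≡ length q + palCount _≟_ v
  palCount-once-suffix v q once = begin
    palCount _≟_ (v ++ q)                          ≡⟨ palCount-reverse (v ++ q) ⟨
    palCount _≟_ (reverse (v ++ q))                ≡⟨ cong (palCount _≟_) (reverse-++ v q) ⟩
    palCount _≟_ (reverse q ++ reverse v)          ≡⟨ palCount-once-prefix (reverse q) (reverse v) once-rev ⟩
    length (reverse q) + palCount _≟_ (reverse v)  ≡⟨ cong₂ _+_ (length-reverse q) (palCount-reverse v) ⟩
    length q + palCount _≟_ v                      ∎
    where
    open ≡-Reasoning
    once-rev : ∀ a → a ∈ reverse q → occ _≟_ a (reverse q ++ reverse v) ≤ 1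
    once-rev a a∈ = subst (_≤ 1) (trans (sym (occ-reverse a (v ++ q))) (cong (occ _≟_ a) (reverse-++ v q)))
                          (once a (AnyP.reverse⁻ a∈))

  rich-strip : ∀ w p v q → w ≡ p ++ v ++ q →
               (∀ a → a ∈ p → occ _≟_ a w ≤ 1) → (∀ a → a ∈ q → occ _≟_ a w ≤ 1) →
               Rich _≟_ w ⇔ Rich _≟_ v
  rich-strip .(p ++ v ++ q) p v q refl once-p once-q = shift-⇔ (length p + length q) palindromes letters
    where
    open ≡-Reasoning
    once-q′ : ∀ a → a ∈ q → occ _≟_ a (v ++ q) ≤ 1
    once-q′ a a∈ = ≤-trans (occ-suffix a p (v ++ q)) (once-q a a∈)
    palindromes : palCount _≟_ (p ++ v ++ q) ≡ (length p + length q) + palCount _≟_ v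
    palindromes = begin
      palCount _≟_ (p ++ v ++ q)                  ≡⟨ palCount-once-prefix p (v ++ q) once-p ⟩
      length p + palCount _≟_ (v ++ q)            ≡⟨ cong (length p +_) (palCount-once-suffix v q once-q′) ⟩
      length p + (length q + palCount _≟_ v)      ≡⟨ +-assoc (length p) (length q) _ ⟨
      (length p + length q) + palCount _≟_ v      ∎
    arith : ∀ i j k → suc (i + (j + k)) ≡ (i + k) + suc j
    arith = solve-∀
    letters : suc (length (p ++ v ++ q)) ≡ (length p + length q) + suc (length v)
    letters = begin
      suc (length (p ++ v ++ q))                  ≡⟨ cong suc (trans (length-++ p) (cong (length p +_) (length-++ v))) ⟩
      suc (length p + (length v + length q))      ≡⟨ arith (length p) (length v) (length q) ⟩
      (length p + length q) + suc (length v)      ∎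

  take-prefix : ∀ (xs ys : List A) → take (length xs) (xs ++ ys) ≡ xs
  take-prefix [] ys = refl
  take-prefix (x ∷ xs) ys = cong (x ∷_) (take-prefix xs ys)

  drop-prefix : ∀ (xs ys : List A) → drop (length xs) (xs ++ ys) ≡ ys
  drop-prefix [] ys = refl
  drop-prefix (x ∷ xs) ys = drop-prefix xs ys

  middle : ∀ (w r m s : List A) → w ≡ r ++ m ++ s → drop (length r) (take (length w ∸ length s) w) ≡ m
  middle .(r ++ m ++ s) r m s refl = begin
    drop (length r) (take (length (r ++ m ++ s) ∸ length s) (r ++ m ++ s))
      ≡⟨ cong₂ (λ n t → drop (length r) (take n t)) cut (sym (++-assoc r m s)) ⟩
    drop (length r) (take (length (r ++ m)) ((r ++ m) ++ s))
      ≡⟨ cong (drop (length r)) (take-prefix (r ++ m) s) ⟩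
    drop (length r) (r ++ m)
      ≡⟨ drop-prefix r m ⟩
    m ∎
    where
    open ≡-Reasoning
    cut : length (r ++ m ++ s) ∸ length s ≡ length (r ++ m)
    cut = trans (cong (λ t → length t ∸ length s) (sym (++-assoc r m s)))
                (trans (cong (_∸ length s) (length-++ (r ++ m))) (m+n∸n≡m _ (length s)))

  prefix-compare : ∀ (xs ys us vs : List A) → xs ++ ys ≡ us ++ vs → length xs ≤ length us →
                   ∃[ m ] us ≡ xs ++ m
  prefix-compare [] ys us vs e le = us , refl
  prefix-compare (x ∷ xs) ys (u ∷ us) vs e (s≤s le) with ∷-injective e
  ... | refl , e′ = let (m , us≡) = prefix-compare xs ys us vs e′ le in m , cong (x ∷_) us≡

  Alph-length-distinct : ∀ w → (∀ a → a ∈ w → occ _≟_ a w ≤ 1) → length (Alph _≟_ w) ≡ length w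
  Alph-length-distinct [] once = refl
  Alph-length-distinct (x ∷ w) once =
    trans (dedup-length-fresh _≟_ (occ-head≤1⇒∉ x w (once x (here refl))))
          (cong suc (Alph-length-distinct w once-tail))
    where
    once-tail : ∀ b → b ∈ w → occ _≟_ b w ≤ 1
    once-tail b b∈w = ≤-trans (occ-suffix b [ x ] w) (once b (there b∈w))

  prefR-once : ∀ w a → a ∈ prefR _≟_ w → occ _≟_ a w ≡ 1
  prefR-once w a = All.lookup (all-takeWhile (once? _≟_ w) w)

  sufS-once : ∀ w a → a ∈ sufS _≟_ w → occ _≟_ a w ≡ 1
  sufS-once w a a∈ = All.lookup (all-takeWhile (once? _≟_ w) (reverse w)) (AnyP.reverse⁻ a∈)

  prefR-split : ∀ w → prefR _≟_ w ++ dropWhile (once? _≟_ w) w ≡ w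
  prefR-split w = takeWhile++dropWhile (once? _≟_ w) w

  sufS-split : ∀ w → reverse (dropWhile (once? _≟_ w) (reverse w)) ++ sufS _≟_ w ≡ w
  sufS-split w = begin
    reverse d ++ reverse t ≡⟨ reverse-++ t d ⟨
    reverse (t ++ d)       ≡⟨ cong reverse (takeWhile++dropWhile (once? _≟_ w) (reverse w)) ⟩
    reverse (reverse w)    ≡⟨ reverse-involutive w ⟩
    w                      ∎
    where
    open ≡-Reasoning
    t = takeWhile (once? _≟_ w) (reverse w)
    d = dropWhile (once? _≟_ w) (reverse w)

  heart-short : ∀ w → ¬ (length (Alph _≟_ w) < length w) → heart _≟_ w ≡ w
  heart-short w short with length (Alph _≟_ w) <? length w
  ... | yes long = ⊥-elim (short long)
  ... | no _ = refl

  heart-long : ∀ w → length (Alph _≟_ w) < length w →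
               heart _≟_ w ≡ drop (length (prefR _≟_ w)) (take (length w ∸ length (sufS _≟_ w)) w)
  heart-long w long with length (Alph _≟_ w) <? length w
  ... | yes _ = refl
  ... | no short = ⊥-elim (short long)

  module Ends (w : List A) where
    r s rest front : List A
    r = prefR _≟_ w
    s = sufS _≟_ w
    rest = dropWhile (once? _≟_ w) w
    front = reverse (dropWhile (once? _≟_ w) (reverse w))

    -- If r reaches over front, every letter of w lies in r or in s and so
    -- occurs once: w has no repeated letter.
    overlap⇒distinct : length front ≤ length r → length (Alph _≟_ w) ≡ length w
    overlap⇒distinct front≤r = Alph-length-distinct w once
      where
      r≡ : ∃[ m ] r ≡ front ++ m
      r≡ = prefix-compare front s r rest (trans (sufS-split w) (sym (prefR-split w))) front≤r
      once : ∀ a → a ∈ w → occ _≟_ a w ≤ 1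
      once a a∈w with ∈-++⁻ front (subst (a ∈_) (sym (sufS-split w)) a∈w)
      ... | inj₁ a∈front = ≤-reflexive (prefR-once w a (subst (a ∈_) (sym (proj₂ r≡)) (∈-++⁺ˡ a∈front)))
      ... | inj₂ a∈s = ≤-reflexive (sufS-once w a a∈s)

    -- Otherwise front = r ++ m, so w = r ++ m ++ s, and m is the heart.
    disjoint⇒decomposition : length (Alph _≟_ w) < length w → length r ≤ length front →
                             w ≡ r ++ heart _≟_ w ++ s
    disjoint⇒decomposition long r≤front =
      subst (λ h → w ≡ r ++ h ++ s) (sym (trans (heart-long w long) (middle w r m s w≡))) w≡
      where
      front≡ : ∃[ m ] front ≡ r ++ m
      front≡ = prefix-compare r rest front s (trans (prefR-split w) (sym (sufS-split w))) r≤front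
      m : List A
      m = proj₁ front≡
      w≡ : w ≡ r ++ m ++ s
      w≡ = trans (sym (sufS-split w)) (trans (cong (_++ s) (proj₂ front≡)) (++-assoc r m s))

  heart-decomposition : ∀ w → length (Alph _≟_ w) < length w →
                        w ≡ prefR _≟_ w ++ heart _≟_ w ++ sufS _≟_ w
  heart-decomposition w long with ≤-total (length (Ends.r w)) (length (Ends.front w))
  ... | inj₁ r≤front = Ends.disjoint⇒decomposition w long r≤front
  ... | inj₂ front≤r = ⊥-elim (<⇒≢ long (Ends.overlap⇒distinct w front≤r))

lemma3p15 : {A : Set} (_≟_ : DecidableEquality A) (w : List A) →
    IsGT _≟_ w → (Rich _≟_ w ⇔ Rich _≟_ (heart _≟_ w))
lemma3p15 _≟_ w _ = by-cases (length (Alph _≟_ w) <? length w)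
  where
  by-cases : Dec (length (Alph _≟_ w) < length w) → Rich _≟_ w ⇔ Rich _≟_ (heart _≟_ w)
  by-cases (no short) = subst (λ v → Rich _≟_ w ⇔ Rich _≟_ v) (sym (heart-short _≟_ w short)) ⇔.refl
  by-cases (yes long) =
    rich-strip _≟_ w (prefR _≟_ w) (heart _≟_ w) (sufS _≟_ w) (heart-decomposition _≟_ w long)
      (λ a a∈ → ≤-reflexive (prefR-once _≟_ w a a∈))
      (λ a a∈ → ≤-reflexive (sufS-once _≟_ w a a∈))
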